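{- Let $H$ be a br-graph and let $S$ be any subset of the properties {idempotence, conservativity, 3-NU, WNU}. Then $H$ has a polymorphism satisfying all properties in $S$ if and only if $H\times P$ has a parity symmetric polymorphism satisfying all properties in $S$.
   Context: A br-graph is a pair of graphs (red edges, blue edges, loops allowed) on a common vertex set. $P$ is the irreflexive br-graph on $\{0,1\}$ whose single edge $01$ is both red and blue. $H\times P$ has vertex set $V(H)\times\{0,1\}$, with $(u,i)(v,j)$ a red (resp. blue) edge iff $uv$ is a red (resp. blue) edge of $H$ and $i\neq j$. The parity switch map $p:(v,i)\mapsto(v,1-i)$ is an automorphism of $H\times P$; a $k$-ary polymorphism $\Phi$ of $H\times P$ is parity symmetric if $\Phi(p(v_1),\dots,p(v_k))=p(\Phi(v_1,\dots,v_k))$ for all arguments. A $k$-ary polymorphism of a br-graph $K$ is a map $V(K)^k\to V(K)$ sending $k$-tuples of red (resp. blue) edges coordinatewise to a red (resp. blue) edge. Idempotent: $\phi(x,\dots,x)=x$; conservative: $\phi(x_1,\dots,x_k)\in\{x_1,\dots,x_k\}$; 3-NU (ternary): $\phi(x,x,y)=\phi(x,y,x)=\phi(y,x,x)=x$; WNU: idempotent and $\phi(x,\dots,x,y)=\phi(x,\dots,y,x)=\dots=\phi(y,x,\dots,x)$. -}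

module Defs where

open import Data.Nat using (ℕ; _≤_)
open import Data.Fin using (Fin; _≟_)
open import Data.Bool using (Bool; true; false; T; not; _∧_; _xor_; if_then_else_)
open import Data.Product using (Σ; ∃; _×_; _,_)
open import Relation.Nullary.Decidable using (⌊_⌋)
open import Relation.Binary.PropositionalEquality using (_≡_)
open import Function.Bundles using (_⇔_)

-- A br-graph on vertex type V: a red graph and a blue graph (undirected,
-- loops allowed), given by decidable (Bool-valued) symmetric edge relations.
record BrGraph (V : Set) : Set where
  field
    red       : V → V → Bool
    blue      : V → V → Bool
    red-sym   : ∀ u v → red u v ≡ red v u
    blue-sym  : ∀ u v → blue u v ≡ blue v u
open BrGraph public

_×P : ∀ {V} → BrGraph V → BrGraph (V × Bool)
_×P H = record
  { red  = λ { (u , i) (v , j) → red H u v ∧ (i xor j) }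
  ; blue = λ { (u , i) (v , j) → blue H u v ∧ (i xor j) }
  ; red-sym  = λ { (u , i) (v , j) → lemma (red H) (red-sym H) u v i j }
  ; blue-sym = λ { (u , i) (v , j) → lemma (blue H) (blue-sym H) u v i j }
  }
  where
  open import Relation.Binary.PropositionalEquality using (cong₂)
  xor-comm : ∀ i j → (i xor j) ≡ (j xor i)
  xor-comm false false = _≡_.refl
  xor-comm false true  = _≡_.refl
  xor-comm true  false = _≡_.refl
  xor-comm true  true  = _≡_.refl
  lemma : ∀ {V : Set} (r : V → V → Bool) → (∀ u v → r u v ≡ r v u) →
          ∀ u v i j → (r u v ∧ (i xor j)) ≡ (r v u ∧ (j xor i))
  lemma r s u v i j = cong₂ _∧_ (s u v) (xor-comm i j)

parity : ∀ {V : Set} → V × Bool → V × Bool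
parity (v , i) = (v , not i)

Op : Set → ℕ → Set
Op V k = (Fin k → V) → V

IsPolymorphism : ∀ {V} → BrGraph V → ∀ {k} → Op V k → Set
IsPolymorphism {V} H {k} φ =
  (∀ (x y : Fin k → V) → (∀ i → T (red H (x i) (y i))) → T (red H (φ x) (φ y))) ×
  (∀ (x y : Fin k → V) → (∀ i → T (blue H (x i) (y i))) → T (blue H (φ x) (φ y)))

oneAt : ∀ {V : Set} {k} → Fin k → V → V → Fin k → V
oneAt j x y i = if ⌊ i ≟ j ⌋ then y else x

IsIdempotent : ∀ {V k} → Op V k → Set
IsIdempotent φ = ∀ x → φ (λ _ → x) ≡ x

IsConservative : ∀ {V k} → Op V k → Set
IsConservative {V} {k} φ = ∀ (x : Fin k → V) → ∃ λ i → φ x ≡ x i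

Is3NU : ∀ {V k} → Op V k → Set
Is3NU {V} {k} φ = (k ≡ 3) × (∀ (x y : V) (j : Fin k) → φ (oneAt j x y) ≡ x)

IsWNU : ∀ {V k} → Op V k → Set
IsWNU {V} {k} φ = (2 ≤ k) × IsIdempotent φ ×
  (∀ (x y : V) (j j′ : Fin k) → φ (oneAt j x y) ≡ φ (oneAt j′ x y))

-- The four properties; a set S of them is a predicate Property → Bool.
data Property : Set where
  idempotence conservativity 3-NU WNU : Property

Satisfies : ∀ {V k} → Property → Op V k → Set
Satisfies idempotence    φ = IsIdempotent φ
Satisfies conservativity φ = IsConservative φ
Satisfies 3-NU           φ = Is3NU φ
Satisfies WNU            φ = IsWNU φ

SatisfiesAll : ∀ {V k} → (Property → Bool) → Op V k → Set
SatisfiesAll S φ = ∀ P → T (S P) → Satisfies P φ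

HasPolymorphism : ∀ {V} → BrGraph V → (Property → Bool) → Set
HasPolymorphism {V} H S =
  Σ ℕ λ k → Σ (Op V k) λ φ → IsPolymorphism H φ × SatisfiesAll S φ

IsParitySymmetric : ∀ {V k} → Op (V × Bool) k → Set
IsParitySymmetric {V} {k} Φ =
  ∀ (x : Fin k → V × Bool) → Φ (λ i → parity (x i)) ≡ parity (Φ x)

HasParitySymPolymorphism : ∀ {V} → BrGraph V → (Property → Bool) → Set
HasParitySymPolymorphism {V} H S =
  Σ ℕ λ k → Σ (Op (V × Bool) k) λ Φ →
    IsPolymorphism (H ×P) Φ × IsParitySymmetric Φ × SatisfiesAll S Φ

module Submission where

-- Forward: from a polymorphism φ of H of arity at least 3 (smaller arities are first
-- raised, a binary φ becoming (x₁ ∙ x₂) ∙ (x₃ ∙ x₄)) define Φ on H × P whose parity is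
-- the majority parity of the first three arguments, and whose vertex is φ applied to
-- the argument vertices after the vertex of every argument of minority parity has been
-- replaced by that of a fixed argument of majority parity. Adjacent tuples of H × P have complementary parities,
-- so they are modified at the same positions, which makes Φ a parity symmetric
-- polymorphism. Backward: φ(x) is the vertex of Φ((x₁,0),…,(xₖ,0)); parity symmetry
-- turns an edge of H into an edge of H × P between (x,0)-tuples and (y,1)-tuples.
--
-- An operation sees its argument as a function Fin k → V, and without function
-- extensionality it may distinguish pointwise equal tuples, while the identities
-- defining the properties refer to particular tuples (λ _ → x, oneAt j x y). So every
-- operation is first replaced by one evaluating it on a canonical representative
-- computed from the vector of argument values.

open import Defs
open import Data.Nat using (ℕ; zero; suc; _+_; _≤_; s≤s; z≤n)
open import Data.Nat.Properties using (≤⇒≯)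
open import Data.Fin using (Fin; zero; suc; _≟_)
open import Data.Fin.Properties using (any?; all?)
import Data.Fin.Properties as Fin
open import Data.Vec using (Vec; []; _∷_; lookup; tabulate)
open import Data.Vec.Properties using (lookup∘tabulate; tabulate-cong)
open import Data.Bool using (Bool; true; false; T; not; _∧_; _xor_; if_then_else_)
open import Data.Bool.Properties
  using (T?; T-∧; T-≡; xor-same; xor-annihilates-not; xor-inverseˡ; xor-inverseʳ)
import Data.Bool.Properties as Bool
open import Data.Product using (Σ; ∃; _×_; _,_; proj₁; proj₂)
open import Data.Product.Relation.Binary.Lex.Strict using (×-Lex; ×-compare)
open import Data.Product.Relation.Binary.Pointwise.NonDependent using (≡×≡⇒≡; ≡⇒≡×≡)
open import Data.Sum using (_⊎_; inj₁; inj₂)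
open import Function using (_∘_; Equivalence; _⇔_; mk⇔)
open import Relation.Binary using (Rel; Trichotomous; tri<; tri≈; tri>)
open import Relation.Binary.Consequences using (tri⇒dec≈)
open import Relation.Binary.PropositionalEquality
open import Relation.Nullary using (Dec; yes; no; contradiction)

module _ {A : Set} {k : ℕ} where

  oneAt-≡ : ∀ {i j : Fin k} (x y : A) → i ≡ j → oneAt j x y i ≡ y
  oneAt-≡ {i} {j} x y i≡j with i ≟ j
  ... | yes _ = refl
  ... | no i≢j = contradiction i≡j i≢j

  oneAt-≢ : ∀ {i j : Fin k} (x y : A) → i ≢ j → oneAt j x y i ≡ x
  oneAt-≢ {i} {j} x y i≢j with i ≟ j
  ... | yes i≡j = contradiction i≡j i≢j
  ... | no _ = refl

  oneAt-same : ∀ (j : Fin k) (x : A) → oneAt j x x ≗ λ _ → x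
  oneAt-same j x i with i ≟ j
  ... | yes _ = refl
  ... | no _ = refl

  oneAt-map : ∀ {B : Set} (f : A → B) (j : Fin k) (x y : A) →
              f ∘ oneAt j x y ≗ oneAt j (f x) (f y)
  oneAt-map f j x y i with i ≟ j
  ... | yes _ = refl
  ... | no _ = refl

other : ∀ {k} → Fin (suc (suc k)) → Fin (suc (suc k))
other zero = suc zero
other (suc _) = zero

other-≢ : ∀ {k} (j : Fin (suc (suc k))) → other j ≢ j
other-≢ zero ()
other-≢ (suc j) ()

avoiding : ∀ {k} (j j′ : Fin (3 + k)) → ∃ λ i → i ≢ j × i ≢ j′
avoiding zero          zero          = suc zero , (λ ()) , (λ ())
avoiding zero          (suc zero)    = suc (suc zero) , (λ ()) , (λ ())
avoiding zero          (suc (suc _)) = suc zero , (λ ()) , (λ ())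
avoiding (suc zero)    zero          = suc (suc zero) , (λ ()) , (λ ())
avoiding (suc (suc _)) zero          = suc zero , (λ ()) , (λ ())
avoiding (suc _)       (suc _)       = zero , (λ ()) , (λ ())

oneAt-position : ∀ {A : Set} {k} {j j′ : Fin (3 + k)} {x y x′ y′ : A} → x ≢ y →
                 oneAt j x y ≗ oneAt j′ x′ y′ → j ≡ j′
oneAt-position {j = j} {j′} {x} {y} {x′} {y′} x≢y same with j ≟ j′
... | yes j≡j′ = j≡j′
... | no j≢j′ = contradiction x≡y x≢y
  where
  i = proj₁ (avoiding j j′)
  x≡y : x ≡ y
  x≡y = begin
    x                ≡⟨ oneAt-≢ x y (proj₁ (proj₂ (avoiding j j′))) ⟨
    oneAt j x y i    ≡⟨ same i ⟩
    oneAt j′ x′ y′ i ≡⟨ oneAt-≢ x′ y′ (proj₂ (proj₂ (avoiding j j′))) ⟩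
    x′               ≡⟨ oneAt-≢ x′ y′ j≢j′ ⟨
    oneAt j′ x′ y′ j ≡⟨ same j ⟨
    oneAt j x y j    ≡⟨ oneAt-≡ x y refl ⟩
    y                ∎
    where open ≡-Reasoning

Extensional : ∀ {V k} → Op V k → Set
Extensional φ = ∀ {x y} → x ≗ y → φ x ≡ φ y

ReadsPointwise : ∀ {V k} → Op V k → Op V k → Set
ReadsPointwise ψ φ = ∀ x → ∃ λ x′ → x′ ≗ x × ψ x ≡ φ x′

reads-refl : ∀ {V k} (φ : Op V k) → ReadsPointwise φ φ
reads-refl φ x = x , (λ _ → refl) , refl

Preserves : ∀ {V k} → (V → V → Bool) → Op V k → Set
Preserves e φ = ∀ x y → (∀ i → T (e (x i) (y i))) → T (e (φ x) (φ y))

polymorphism-map : ∀ {V : Set} {k m} {φ : Op V k} {ψ : Op V m} {H : BrGraph V} →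
  (∀ e → Preserves e φ → Preserves e ψ) → IsPolymorphism H φ → IsPolymorphism H ψ
polymorphism-map {H = H} f (pres-red , pres-blue) = f (red H) pres-red , f (blue H) pres-blue

module _ {V : Set} {k : ℕ} {ψ φ : Op V k} (reads : ReadsPointwise ψ φ) where

  preserves-reads : ∀ e → Preserves e φ → Preserves e ψ
  preserves-reads e pres x y xy with reads x | reads y
  ... | x′ , x′≗x , ψx≡φx′ | y′ , y′≗y , ψy≡φy′ =
    subst₂ (λ u v → T (e u v)) (sym ψx≡φx′) (sym ψy≡φy′)
      (pres x′ y′ λ i → subst₂ (λ u v → T (e u v)) (sym (x′≗x i)) (sym (y′≗y i)) (xy i))

  conservative-reads : IsConservative φ → IsConservative ψ
  conservative-reads cons x with reads x
  ... | x′ , x′≗x , ψx≡φx′ with cons x′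
  ...   | i , φx′≡x′i = i , trans ψx≡φx′ (trans φx′≡x′i (x′≗x i))

-- Idempotence and WNU fix constant tuples written λ _ → a, while 3-NU only fixes the
-- tuples oneAt j a a; canonical representatives of constant tuples must take the form
-- that the given properties control.
constantForm : ∀ {A : Set} {k} (S : Property → Bool) (φ : Op A (suc k)) → SatisfiesAll S φ →
  Σ (A → Fin (suc k) → A) λ c → (∀ a → c a ≗ λ _ → a) ×
    (T (S idempotence) ⊎ T (S WNU) ⊎ T (S 3-NU) → ∀ a → φ (c a) ≡ a)
constantForm S φ sat with T? (S idempotence) | T? (S WNU) | T? (S 3-NU)
... | yes t | _ | _ = (λ a _ → a) , (λ _ _ → refl) , λ _ → sat idempotence t
... | no _ | yes t | _ = (λ a _ → a) , (λ _ _ → refl) , λ _ → proj₁ (proj₂ (sat WNU t))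
... | no _ | no _ | yes t = (λ a → oneAt zero a a) , oneAt-same zero ,
                             λ _ a → proj₂ (sat 3-NU t) a a zero
... | no ¬i | no ¬w | no ¬n = (λ a _ → a) , (λ _ _ → refl) ,
  λ { (inj₁ t) → contradiction t ¬i
    ; (inj₂ (inj₁ t)) → contradiction t ¬w
    ; (inj₂ (inj₂ t)) → contradiction t ¬n
    }

module Canonical {A : Set} {ℓ} {_<_ : Rel A ℓ} (compare : Trichotomous _≡_ _<_) where

  private
    _≟ᴬ_ = tri⇒dec≈ compare

  OddOneOutAt : ∀ {k} → Vec A (2 + k) → Fin (2 + k) → Set
  OddOneOutAt v j = ∀ i → lookup v i ≡ oneAt j (lookup v (other j)) (lookup v j) i

  oddOneOutAt? : ∀ {k} (v : Vec A (2 + k)) j → Dec (OddOneOutAt v j)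
  oddOneOutAt? v j = all? λ i → lookup v i ≟ᴬ oneAt j (lookup v (other j)) (lookup v j) i

  canonical : ∀ {k} → (A → Fin (suc k) → A) → Vec A (suc k) → Fin (suc k) → A
  canonical c (a ∷ []) = c a
  -- A pair of distinct values is both oneAt zero and oneAt (suc zero) of some pair; the
  -- order picks one, so that a pair and its swap get representatives with the same
  -- entries and the odd entry moved.
  canonical c (a ∷ b ∷ []) with compare a b
  ... | tri< _ _ _ = oneAt (suc zero) a b
  ... | tri≈ _ _ _ = c a
  ... | tri> _ _ _ = oneAt zero b a
  canonical c v@(a ∷ _ ∷ _ ∷ _) with all? (λ i → lookup v i ≟ᴬ a)
  ... | yes _ = c a
  ... | no _ with any? (oddOneOutAt? v)
  ...   | yes (j , _) = oneAt j (lookup v (other j)) (lookup v j)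
  ...   | no _ = lookup v

  canon : ∀ {k} → (A → Fin (suc k) → A) → (Fin (suc k) → A) → Fin (suc k) → A
  canon c x = canonical c (tabulate x)

  canon-cong : ∀ {k} {c : A → Fin (suc k) → A} {x y} → x ≗ y → canon c x ≡ canon c y
  canon-cong x≗y = cong (canonical _) (tabulate-cong x≗y)

  canonical-≗ : ∀ {k} {c : A → Fin (suc k) → A} → (∀ a → c a ≗ λ _ → a) →
                ∀ v → canonical c v ≗ lookup v
  canonical-≗ c-const (a ∷ []) zero = c-const a zero
  canonical-≗ c-const (a ∷ b ∷ []) i with compare a b
  canonical-≗ c-const (a ∷ b ∷ []) zero       | tri< _ _ _   = refl
  canonical-≗ c-const (a ∷ b ∷ []) (suc zero) | tri< _ _ _   = refl
  canonical-≗ c-const (a ∷ b ∷ []) zero       | tri≈ _ _ _   = c-const a zero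
  canonical-≗ c-const (a ∷ b ∷ []) (suc zero) | tri≈ _ a≡b _ = trans (c-const a (suc zero)) a≡b
  canonical-≗ c-const (a ∷ b ∷ []) zero       | tri> _ _ _   = refl
  canonical-≗ c-const (a ∷ b ∷ []) (suc zero) | tri> _ _ _   = refl
  canonical-≗ c-const v@(a ∷ _ ∷ _ ∷ _) i with all? (λ i → lookup v i ≟ᴬ a)
  ... | yes constant = trans (c-const a i) (sym (constant i))
  ... | no _ with any? (oddOneOutAt? v)
  ...   | yes (j , odd) = sym (odd i)
  ...   | no _ = refl

  canon-≗ : ∀ {k} {c : A → Fin (suc k) → A} → (∀ a → c a ≗ λ _ → a) →
            ∀ x → canon c x ≗ x
  canon-≗ c-const x i = trans (canonical-≗ c-const (tabulate x) i) (lookup∘tabulate x i)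

  canonical-constant : ∀ {k} {c : A → Fin (suc k) → A} v a → (∀ i → lookup v i ≡ a) →
                       canonical c v ≡ c a
  canonical-constant (b ∷ []) a constant = cong _ (constant zero)
  canonical-constant (b ∷ b′ ∷ []) a constant with compare b b′
  ... | tri≈ _ _ _    = cong _ (constant zero)
  ... | tri< _ b≢b′ _ = contradiction (trans (constant zero) (sym (constant (suc zero)))) b≢b′
  ... | tri> _ b≢b′ _ = contradiction (trans (constant zero) (sym (constant (suc zero)))) b≢b′
  canonical-constant v@(b ∷ _ ∷ _ ∷ _) a constant with all? (λ i → lookup v i ≟ᴬ b)
  ... | yes _ = cong _ (constant zero)
  ... | no ¬constant = contradiction (λ i → trans (constant i) (sym (constant zero))) ¬constant

  canon-constant : ∀ {k} {c : A → Fin (suc k) → A} a → canon c (λ _ → a) ≡ c a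
  canon-constant a = canonical-constant (tabulate (λ _ → a)) a (lookup∘tabulate (λ _ → a))

  canon-oneAt-same : ∀ {k} {c : A → Fin (suc k) → A} j a → canon c (oneAt j a a) ≡ c a
  canon-oneAt-same j a = trans (canon-cong (oneAt-same j a)) (canon-constant a)

  canonical-oddOneOut : ∀ {k} {c : A → Fin (3 + k) → A} v j →
    lookup v (other j) ≢ lookup v j → OddOneOutAt v j →
    canonical c v ≡ oneAt j (lookup v (other j)) (lookup v j)
  canonical-oddOneOut v@(a ∷ _ ∷ _ ∷ _) j distinct odd with all? (λ i → lookup v i ≟ᴬ a)
  ... | yes constant = contradiction (trans (constant (other j)) (sym (constant j))) distinct
  ... | no _ with any? (oddOneOutAt? v)
  ...   | no ¬odd = contradiction (j , odd) ¬odd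
  ...   | yes (j′ , odd′) with oneAt-position distinct (λ i → trans (sym (odd i)) (odd′ i))
  ...     | refl = refl

  canon-oneAt : ∀ {k} {c : A → Fin (3 + k) → A} j {x y} → x ≢ y →
                canon c (oneAt j x y) ≡ oneAt j x y
  canon-oneAt j {x} {y} x≢y =
    trans (canonical-oddOneOut v j (λ eq → x≢y (trans (sym vo) (trans eq vj))) odd)
          (cong₂ (oneAt j) vo vj)
    where
    v = tabulate (oneAt j x y)
    vj : lookup v j ≡ y
    vj = trans (lookup∘tabulate (oneAt j x y) j) (oneAt-≡ x y refl)
    vo : lookup v (other j) ≡ x
    vo = trans (lookup∘tabulate (oneAt j x y) (other j)) (oneAt-≢ x y (other-≢ j))
    odd : OddOneOutAt v j
    odd i = trans (lookup∘tabulate (oneAt j x y) i) (sym (cong₂ (λ a b → oneAt j a b i) vo vj))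

  canonical-swap : ∀ {c : A → Fin 2 → A} (φ : Op A 2) →
    (∀ x y → φ (oneAt zero x y) ≡ φ (oneAt (suc zero) x y)) →
    ∀ a b → φ (canonical c (a ∷ b ∷ [])) ≡ φ (canonical c (b ∷ a ∷ []))
  canonical-swap φ swap a b with compare a b | compare b a
  ... | tri< _ _ _     | tri> _ _ _     = sym (swap a b)
  ... | tri> _ _ _     | tri< _ _ _     = swap b a
  ... | tri≈ _ refl _  | tri≈ _ _ _     = refl
  ... | tri< _ _ b≮a   | tri< b<a _ _   = contradiction b<a b≮a
  ... | tri> a≮b _ _   | tri> _ _ a<b   = contradiction a<b a≮b
  ... | tri< _ a≢b _   | tri≈ _ b≡a _   = contradiction (sym b≡a) a≢b
  ... | tri> _ a≢b _   | tri≈ _ b≡a _   = contradiction (sym b≡a) a≢b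
  ... | tri≈ _ a≡b _   | tri< _ b≢a _   = contradiction (sym a≡b) b≢a
  ... | tri≈ _ a≡b _   | tri> _ b≢a _   = contradiction (sym a≡b) b≢a

  canonicalised : ∀ {k} → (A → Fin (suc k) → A) → Op A (suc k) → Op A (suc k)
  canonicalised c φ x = φ (canon c x)

  module _ {k} {c : A → Fin (suc k) → A} (φ : Op A (suc k)) where

    canonicalised-extensional : Extensional (canonicalised c φ)
    canonicalised-extensional x≗y = cong φ (canon-cong x≗y)

    canonicalised-reads : (∀ a → c a ≗ λ _ → a) → ReadsPointwise (canonicalised c φ) φ
    canonicalised-reads c-const x = canon c x , canon-≗ c-const x , refl

    canonicalised-idempotent : (∀ a → φ (c a) ≡ a) → IsIdempotent (canonicalised c φ)
    canonicalised-idempotent fixes a = trans (cong φ (canon-constant a)) (fixes a)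

  canonicalised-3NU : ∀ {k} {c : A → Fin (suc k) → A} (φ : Op A (suc k)) →
    (∀ a → φ (c a) ≡ a) → Is3NU φ → Is3NU (canonicalised c φ)
  canonicalised-3NU φ fixes (refl , nu) = refl , nu′
    where
    nu′ : ∀ x y j → canonicalised _ φ (oneAt j x y) ≡ x
    nu′ x y j with x ≟ᴬ y
    ... | yes refl = trans (cong φ (canon-oneAt-same j x)) (fixes x)
    ... | no x≢y = trans (cong φ (canon-oneAt j x≢y)) (nu x y j)

  canonicalised-WNU : ∀ {k} {c : A → Fin (suc k) → A} (φ : Op A (suc k)) →
    (∀ a → φ (c a) ≡ a) → IsWNU φ → IsWNU (canonicalised c φ)
  canonicalised-WNU {zero} φ fixes (s≤s () , _)
  canonicalised-WNU {suc zero} φ fixes (2≤k , _ , wnu) =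
    2≤k , canonicalised-idempotent φ fixes , binary
    where
    swap = canonical-swap φ (λ x y → wnu x y zero (suc zero))
    binary : ∀ x y j j′ → canonicalised _ φ (oneAt j x y) ≡ canonicalised _ φ (oneAt j′ x y)
    binary x y zero       zero       = refl
    binary x y zero       (suc zero) = swap y x
    binary x y (suc zero) zero       = sym (swap y x)
    binary x y (suc zero) (suc zero) = refl
  canonicalised-WNU {suc (suc k)} φ fixes (2≤k , _ , wnu) =
    2≤k , canonicalised-idempotent φ fixes , wnu′
    where
    wnu′ : ∀ x y j j′ → canonicalised _ φ (oneAt j x y) ≡ canonicalised _ φ (oneAt j′ x y)
    wnu′ x y j j′ with x ≟ᴬ y
    ... | yes refl = cong φ (trans (canon-oneAt-same j x) (sym (canon-oneAt-same j′ x)))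
    ... | no x≢y = trans (cong φ (canon-oneAt j x≢y))
                         (trans (wnu x y j j′) (cong φ (sym (canon-oneAt j′ x≢y))))

  extensionalise : ∀ {k} S (φ : Op A (suc k)) → SatisfiesAll S φ →
    Σ (Op A (suc k)) λ ψ → Extensional ψ × ReadsPointwise ψ φ × SatisfiesAll S ψ
  extensionalise S φ sat with constantForm S φ sat
  ... | c , c-const , fixes =
    canonicalised c φ , canonicalised-extensional φ , canonicalised-reads φ c-const , sat′
    where
    sat′ : SatisfiesAll S (canonicalised c φ)
    sat′ idempotence    t = canonicalised-idempotent φ (fixes (inj₁ t))
    sat′ conservativity t =
      conservative-reads (canonicalised-reads φ c-const) (sat conservativity t)
    sat′ 3-NU           t = canonicalised-3NU φ (fixes (inj₂ (inj₂ t))) (sat 3-NU t)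
    sat′ WNU            t = canonicalised-WNU φ (fixes (inj₂ (inj₁ t))) (sat WNU t)

_×ᴾ : ∀ {V : Set} → (V → V → Bool) → V × Bool → V × Bool → Bool
(e ×ᴾ) X Y = e (proj₁ X) (proj₁ Y) ∧ (proj₂ X xor proj₂ Y)

xor-≡-false : ∀ {a b} → a xor b ≡ false → a ≡ b
xor-≡-false {false} {false} _ = refl
xor-≡-false {true}  {true}  _ = refl

xor-≡-true : ∀ {a b} → a xor b ≡ true → b ≡ not a
xor-≡-true {false} {true}  _ = refl
xor-≡-true {true}  {false} _ = refl

module ParityLift {V : Set} {k : ℕ} where

  private
    K = 3 + k
    W = V × Bool

  -- x (pivot x) has the majority parity among the first three arguments.
  pivot : (Fin K → W) → Fin K
  pivot x = if proj₂ (x (suc zero)) xor proj₂ (x (suc (suc zero))) then zero else suc zero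

  majority : (Fin K → W) → Bool
  majority x = proj₂ (x (pivot x))

  source : (Fin K → W) → Fin K → Fin K
  source x i = if proj₂ (x i) xor majority x then pivot x else i

  mask : (Fin K → W) → Fin K → V
  mask x i = proj₁ (x (source x i))

  parityLift : Op V K → Op W K
  parityLift φ x = φ (mask x) , majority x

  record Flipped (x y : Fin K → W) : Set where
    constructor flipped
    field parity-flipped : ∀ i → proj₂ (y i) ≡ not (proj₂ (x i))

  pivot-flipped : ∀ {x y} → Flipped x y → pivot y ≡ pivot x
  pivot-flipped {x} (flipped flip) = cong (λ b → if b then zero else suc zero)
    (trans (cong₂ _xor_ (flip (suc zero)) (flip (suc (suc zero))))
           (xor-annihilates-not (proj₂ (x (suc zero))) (proj₂ (x (suc (suc zero))))))

  majority-flipped : ∀ {x y} → Flipped x y → majority y ≡ not (majority x)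
  majority-flipped {x} {y} flip =
    trans (cong (proj₂ ∘ y) (pivot-flipped flip)) (Flipped.parity-flipped flip (pivot x))

  source-flipped : ∀ {x y} → Flipped x y → source y ≗ source x
  source-flipped {x} flip i = cong₂ (λ b p → if b then p else i)
    (trans (cong₂ _xor_ (Flipped.parity-flipped flip i) (majority-flipped flip))
           (xor-annihilates-not (proj₂ (x i)) (majority x)))
    (pivot-flipped flip)

  source-majority : ∀ x i → proj₂ (x (source x i)) ≡ majority x
  source-majority x i with proj₂ (x i) xor majority x in eq
  ... | true  = refl
  ... | false = xor-≡-false eq

  source-agreeing : ∀ x {i} → proj₂ (x i) ≡ majority x → source x i ≡ i
  source-agreeing x {i} agree =
    cong (λ b → if b then pivot x else i)
         (trans (cong (_xor majority x) agree) (xor-same (majority x)))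

  source-disagreeing : ∀ x {i} → proj₂ (x i) ≡ not (majority x) → source x i ≡ pivot x
  source-disagreeing x {i} disagree =
    cong (λ b → if b then pivot x else i)
         (trans (cong (_xor majority x) disagree) (xor-inverseˡ (majority x)))

  parityLift-preserves : ∀ e {φ : Op V K} → Preserves e φ → Preserves (e ×ᴾ) (parityLift φ)
  parityLift-preserves e {φ} pres x y xy = Equivalence.from T-∧ (vertices , parities)
    where
    flip : Flipped x y
    flip = flipped λ i → xor-≡-true (Equivalence.to T-≡ (proj₂ (Equivalence.to T-∧ (xy i))))
    vertices : T (e (φ (mask x)) (φ (mask y)))
    vertices = pres (mask x) (mask y) λ i →
      subst (λ j → T (e (mask x i) (proj₁ (y j)))) (sym (source-flipped flip i))
            (proj₁ (Equivalence.to T-∧ (xy (source x i))))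
    parities : T (majority x xor majority y)
    parities = Equivalence.from T-≡
      (trans (cong (majority x xor_) (majority-flipped flip)) (xor-inverseʳ (majority x)))

  parityLift-polymorphism : ∀ {H : BrGraph V} {φ : Op V K} → IsPolymorphism H φ →
                            IsPolymorphism (H ×P) (parityLift φ)
  parityLift-polymorphism {H} {φ} (pres-red , pres-blue) =
    parityLift-preserves (red H) {φ} pres-red , parityLift-preserves (blue H) {φ} pres-blue

  parityLift-paritySymmetric : ∀ {φ : Op V K} → Extensional φ → IsParitySymmetric (parityLift φ)
  parityLift-paritySymmetric ext x =
    cong₂ _,_ (ext λ i → cong (proj₁ ∘ x) (source-flipped flip i)) (majority-flipped flip)
    where
    flip : Flipped x (λ i → parity (x i))
    flip = flipped λ _ → refl

  parityLift-idempotent : ∀ {φ : Op V K} → IsIdempotent φ → IsIdempotent (parityLift φ)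
  parityLift-idempotent idem X = cong (_, proj₂ X) (idem (proj₁ X))

  parityLift-conservative : ∀ {φ : Op V K} → IsConservative φ → IsConservative (parityLift φ)
  parityLift-conservative {φ} cons x with cons (mask x)
  ... | i , φmask≡ = source x i , cong₂ _,_ φmask≡ (sym (source-majority x i))

  pivot-oneAt : ∀ (j : Fin K) {X Y : W} → proj₂ Y ≡ not (proj₂ X) →
                oneAt j X Y (pivot (oneAt j X Y)) ≡ X
  pivot-oneAt zero                {X}     _    rewrite xor-same (proj₂ X) = refl
  pivot-oneAt (suc zero)          {X}     flip rewrite flip | xor-inverseˡ (proj₂ X) = refl
  pivot-oneAt (suc (suc zero))    {X} {Y} _    with proj₂ X xor proj₂ Y
  ... | true  = refl
  ... | false = refl
  pivot-oneAt (suc (suc (suc _))) {X}     _    rewrite xor-same (proj₂ X) = refl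

  parity-oneAt : ∀ (j : Fin K) {X Y : W} → proj₂ X ≡ proj₂ Y → ∀ i → proj₂ (oneAt j X Y i) ≡ proj₂ X
  parity-oneAt j {X} {Y} same i =
    trans (oneAt-map proj₂ j X Y i)
          (trans (cong (λ b → oneAt j (proj₂ X) b i) (sym same)) (oneAt-same j (proj₂ X) i))

  majority-oneAt : ∀ (j : Fin K) (X Y : W) → majority (oneAt j X Y) ≡ proj₂ X
  majority-oneAt j X Y with proj₂ X xor proj₂ Y in eq
  ... | false = parity-oneAt j (xor-≡-false eq) (pivot (oneAt j X Y))
  ... | true  = cong proj₂ (pivot-oneAt j (xor-≡-true eq))

  mask-oneAt-agreeing : ∀ (j : Fin K) {X Y : W} → proj₂ X ≡ proj₂ Y →
                        mask (oneAt j X Y) ≗ oneAt j (proj₁ X) (proj₁ Y)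
  mask-oneAt-agreeing j {X} {Y} same i =
    trans (cong (proj₁ ∘ x) (source-agreeing x agree)) (oneAt-map proj₁ j X Y i)
    where
    x = oneAt j X Y
    agree : proj₂ (x i) ≡ majority x
    agree = trans (parity-oneAt j same i) (sym (majority-oneAt j X Y))

  mask-oneAt-disagreeing : ∀ (j : Fin K) {X Y : W} → proj₂ Y ≡ not (proj₂ X) →
                           mask (oneAt j X Y) ≗ λ _ → proj₁ X
  mask-oneAt-disagreeing j {X} {Y} flip i = cong proj₁ (source-hits-X (i ≟ j))
    where
    x = oneAt j X Y
    source-hits-X : Dec (i ≡ j) → x (source x i) ≡ X
    source-hits-X (yes i≡j) = trans (cong x (source-disagreeing x disagree)) (pivot-oneAt j flip)
      where
      disagree : proj₂ (x i) ≡ not (majority x)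
      disagree = trans (cong proj₂ (oneAt-≡ X Y i≡j))
                       (trans flip (cong not (sym (majority-oneAt j X Y))))
    source-hits-X (no i≢j) = trans (cong x (source-agreeing x agree)) (oneAt-≢ X Y i≢j)
      where
      agree : proj₂ (x i) ≡ majority x
      agree = trans (cong proj₂ (oneAt-≢ X Y i≢j)) (sym (majority-oneAt j X Y))

  oddVertex : W → W → V
  oddVertex X Y = if proj₂ X xor proj₂ Y then proj₁ X else proj₁ Y

  mask-oneAt : ∀ (j : Fin K) (X Y : W) → mask (oneAt j X Y) ≗ oneAt j (proj₁ X) (oddVertex X Y)
  mask-oneAt j X Y i with proj₂ X xor proj₂ Y in eq
  ... | false = mask-oneAt-agreeing j (xor-≡-false eq) i
  ... | true  = trans (mask-oneAt-disagreeing j (xor-≡-true eq) i) (sym (oneAt-same j (proj₁ X) i))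

  parityLift-3NU : ∀ {φ : Op V K} → Extensional φ → Is3NU φ → Is3NU (parityLift φ)
  parityLift-3NU ext (arity , nu) = arity , λ X Y j →
    cong₂ _,_ (trans (ext (mask-oneAt j X Y)) (nu _ _ j)) (majority-oneAt j X Y)

  parityLift-WNU : ∀ {φ : Op V K} → Extensional φ → IsWNU φ → IsWNU (parityLift φ)
  parityLift-WNU {φ} ext (2≤K , idem , wnu) = 2≤K , parityLift-idempotent {φ} idem , λ X Y j j′ →
    cong₂ _,_
      (trans (ext (mask-oneAt j X Y)) (trans (wnu _ _ j j′) (sym (ext (mask-oneAt j′ X Y)))))
      (trans (majority-oneAt j X Y) (sym (majority-oneAt j′ X Y)))

  parityLift-satisfies : ∀ {S} {φ : Op V K} → Extensional φ → SatisfiesAll S φ →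
                         SatisfiesAll S (parityLift φ)
  parityLift-satisfies {φ = φ} ext sat idempotence t = parityLift-idempotent {φ} (sat idempotence t)
  parityLift-satisfies ext sat conservativity t = parityLift-conservative (sat conservativity t)
  parityLift-satisfies ext sat 3-NU           t = parityLift-3NU ext (sat 3-NU t)
  parityLift-satisfies ext sat WNU            t = parityLift-WNU ext (sat WNU t)

diagonal : ∀ {V : Set} {k m} → Op V k → Op V (suc m)
diagonal φ x = φ (λ _ → x zero)

module _ {V : Set} {k m : ℕ} (φ : Op V k) where

  diagonal-extensional : Extensional (diagonal {m = m} φ)
  diagonal-extensional x≗y = cong (λ a → φ (λ _ → a)) (x≗y zero)

  diagonal-preserves : ∀ e → Preserves e φ → Preserves e (diagonal {m = m} φ)
  diagonal-preserves e pres x y xy = pres _ _ λ _ → xy zero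

  diagonal-satisfies : ∀ {S} → k ≤ 1 → SatisfiesAll S φ → SatisfiesAll S (diagonal {m = m} φ)
  diagonal-satisfies k≤1 sat idempotence    t a = sat idempotence t a
  diagonal-satisfies k≤1 sat conservativity t x = zero , proj₂ (sat conservativity t (λ _ → x zero))
  diagonal-satisfies k≤1 sat 3-NU           t with sat 3-NU t
  ... | refl , _ = contradiction k≤1 λ { (s≤s ()) }
  diagonal-satisfies k≤1 sat WNU            t = contradiction (proj₁ (sat WNU t)) (≤⇒≯ k≤1)

module Quaternary {V : Set} (φ : Op V 2) where

  _∙_ : V → V → V
  a ∙ b = φ (oneAt (suc zero) a b)

  quaternary : Op V 4
  quaternary x = (x zero ∙ x (suc zero)) ∙ (x (suc (suc zero)) ∙ x (suc (suc (suc zero))))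

  quaternary-extensional : Extensional quaternary
  quaternary-extensional x≗y =
    cong₂ _∙_ (cong₂ _∙_ (x≗y zero) (x≗y (suc zero)))
              (cong₂ _∙_ (x≗y (suc (suc zero))) (x≗y (suc (suc (suc zero)))))

  ∙-preserves : ∀ e → Preserves e φ →
                ∀ {a a′ b b′} → T (e a a′) → T (e b b′) → T (e (a ∙ b) (a′ ∙ b′))
  ∙-preserves e pres aa′ bb′ = pres _ _ λ { zero → aa′ ; (suc zero) → bb′ }

  quaternary-preserves : ∀ e → Preserves e φ → Preserves e quaternary
  quaternary-preserves e pres x y xy =
    ∙-preserves e pres (∙-preserves e pres (xy zero) (xy (suc zero)))
                       (∙-preserves e pres (xy (suc (suc zero))) (xy (suc (suc (suc zero)))))

  ∙-idempotent : Extensional φ → IsIdempotent φ → ∀ a → a ∙ a ≡ a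
  ∙-idempotent ext idem a = trans (ext (oneAt-same (suc zero) a)) (idem a)

  ∙-comm : Extensional φ → (∀ x y → φ (oneAt zero x y) ≡ φ (oneAt (suc zero) x y)) →
           ∀ a b → a ∙ b ≡ b ∙ a
  ∙-comm ext swap a b = trans (sym (swap a b)) (ext λ { zero → refl ; (suc zero) → refl })

  ∙-conservative : IsConservative φ → ∀ a b → a ∙ b ≡ a ⊎ a ∙ b ≡ b
  ∙-conservative cons a b with cons (oneAt (suc zero) a b)
  ... | zero     , eq = inj₁ eq
  ... | suc zero , eq = inj₂ eq

  quaternary-idempotent : Extensional φ → IsIdempotent φ → IsIdempotent quaternary
  quaternary-idempotent ext idem a = trans (cong₂ _∙_ (∙-idem a) (∙-idem a)) (∙-idem a)
    where
    ∙-idem = ∙-idempotent ext idem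

  quaternary-conservative : IsConservative φ → IsConservative quaternary
  quaternary-conservative cons x
    with ∙-conservative cons (x zero ∙ x (suc zero)) (x (suc (suc zero)) ∙ x (suc (suc (suc zero))))
  ... | inj₁ eq with ∙-conservative cons (x zero) (x (suc zero))
  ...   | inj₁ eq′ = zero , trans eq eq′
  ...   | inj₂ eq′ = suc zero , trans eq eq′
  quaternary-conservative cons x | inj₂ eq
    with ∙-conservative cons (x (suc (suc zero))) (x (suc (suc (suc zero))))
  ...   | inj₁ eq′ = suc (suc zero) , trans eq eq′
  ...   | inj₂ eq′ = suc (suc (suc zero)) , trans eq eq′

  quaternary-WNU : Extensional φ → IsWNU φ → IsWNU quaternary
  quaternary-WNU ext (_ , idem , wnu) =
    s≤s (s≤s z≤n) , quaternary-idempotent ext idem ,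
    λ a b j j′ → trans (common a b j) (sym (common a b j′))
    where
    ∙-idem = ∙-idempotent ext idem
    comm = ∙-comm ext λ x y → wnu x y zero (suc zero)
    common : ∀ a b j → quaternary (oneAt j a b) ≡ (a ∙ b) ∙ a
    common a b zero                   = cong₂ _∙_ (comm b a) (∙-idem a)
    common a b (suc zero)             = cong ((a ∙ b) ∙_) (∙-idem a)
    common a b (suc (suc zero))       = trans (cong₂ _∙_ (∙-idem a) (comm b a)) (comm a (a ∙ b))
    common a b (suc (suc (suc zero))) = trans (cong (_∙ (a ∙ b)) (∙-idem a)) (comm a (a ∙ b))

  quaternary-satisfies : ∀ {S} → Extensional φ → SatisfiesAll S φ → SatisfiesAll S quaternary
  quaternary-satisfies ext sat idempotence    t = quaternary-idempotent ext (sat idempotence t)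
  quaternary-satisfies ext sat conservativity t = quaternary-conservative (sat conservativity t)
  quaternary-satisfies ext sat 3-NU           t with sat 3-NU t
  ... | () , _
  quaternary-satisfies ext sat WNU            t = quaternary-WNU ext (sat WNU t)

module Forward {V : Set} {ℓ} {_<_ : Rel V ℓ} (compare : Trichotomous _≡_ _<_)
               {H : BrGraph V} {S : Property → Bool} where

  open Canonical compare using (extensionalise)
  open Quaternary
  open ParityLift

  HasExtensionalPolymorphism≥3 : Set
  HasExtensionalPolymorphism≥3 =
    Σ ℕ λ k → Σ (Op V (3 + k)) λ φ → Extensional φ × IsPolymorphism H φ × SatisfiesAll S φ

  diagonalised : ∀ {k} (φ : Op V k) → k ≤ 1 → IsPolymorphism H φ → SatisfiesAll S φ →
                 HasExtensionalPolymorphism≥3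
  diagonalised φ k≤1 pol sat =
    0 , diagonal φ , diagonal-extensional φ , polymorphism-map {H = H} (diagonal-preserves φ) pol ,
    diagonal-satisfies φ k≤1 sat

  raiseArity : HasPolymorphism H S → HasExtensionalPolymorphism≥3
  raiseArity (0 , φ , pol , sat) = diagonalised φ z≤n pol sat
  raiseArity (1 , φ , pol , sat) = diagonalised φ (s≤s z≤n) pol sat
  raiseArity (2 , φ , pol , sat) with extensionalise S φ sat
  ... | ψ , ext , reads , satψ =
    1 , quaternary ψ , quaternary-extensional ψ ,
    polymorphism-map {H = H} (quaternary-preserves ψ)
      (polymorphism-map {H = H} (preserves-reads reads) pol) ,
    quaternary-satisfies ψ ext satψ
  raiseArity (suc (suc (suc k)) , φ , pol , sat) with extensionalise S φ sat
  ... | ψ , ext , reads , satψ =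
    k , ψ , ext , polymorphism-map {H = H} (preserves-reads reads) pol , satψ

  forward : HasPolymorphism H S → HasParitySymPolymorphism H S
  forward has with raiseArity has
  ... | k , φ , ext , pol , sat =
    3 + k , parityLift φ , parityLift-polymorphism {H = H} {φ = φ} pol ,
    parityLift-paritySymmetric ext , parityLift-satisfies ext sat

module Projection {V : Set} where

  project : ∀ {k} → Op (V × Bool) k → Op V k
  project Ψ x = proj₁ (Ψ (λ i → x i , false))

  module _ {k} {Ψ Φ : Op (V × Bool) k} where

    project-preserves : ReadsPointwise Ψ Φ → IsParitySymmetric Φ →
                        ∀ e → Preserves (e ×ᴾ) Φ → Preserves e (project Ψ)
    project-preserves reads symmetric e pres x y xy
      with reads (λ i → x i , false) | reads (λ i → y i , false)
    ... | u , u≗ , Ψx≡Φu | w , w≗ , Ψy≡Φw =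
      subst₂ (λ U W′ → T (e (proj₁ U) (proj₁ W′))) (sym Ψx≡Φu) (sym Ψy≡Φw)
        (proj₁ (Equivalence.to T-∧ (subst (λ Z → T ((e ×ᴾ) (Φ u) Z)) (symmetric w) Φu~Φw̄)))
      where
      Φu~Φw̄ : T ((e ×ᴾ) (Φ u) (Φ λ i → parity (w i)))
      Φu~Φw̄ = pres u (λ i → parity (w i)) λ i →
        subst₂ (λ U W′ → T ((e ×ᴾ) U (parity W′))) (sym (u≗ i)) (sym (w≗ i))
               (Equivalence.from T-∧ (xy i , _))

    project-polymorphism : ∀ {H} → ReadsPointwise Ψ Φ → IsParitySymmetric Φ →
                           IsPolymorphism (H ×P) Φ → IsPolymorphism H (project Ψ)
    project-polymorphism {H} reads symmetric (pres-red , pres-blue) =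
      project-preserves reads symmetric (red H) pres-red ,
      project-preserves reads symmetric (blue H) pres-blue

  module _ {k} {Ψ : Op (V × Bool) k} where

    project-idempotent : IsIdempotent Ψ → IsIdempotent (project Ψ)
    project-idempotent idem a = cong proj₁ (idem (a , false))

    project-conservative : IsConservative Ψ → IsConservative (project Ψ)
    project-conservative cons x with cons (λ i → x i , false)
    ... | i , eq = i , cong proj₁ eq

    project-oneAt : Extensional Ψ →
                    ∀ j a b → project Ψ (oneAt j a b) ≡ proj₁ (Ψ (oneAt j (a , false) (b , false)))
    project-oneAt ext j a b = cong proj₁ (ext (oneAt-map (_, false) j a b))

    project-3NU : Extensional Ψ → Is3NU Ψ → Is3NU (project Ψ)
    project-3NU ext (arity , nu) =
      arity , λ a b j → trans (project-oneAt ext j a b) (cong proj₁ (nu _ _ j))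

    project-WNU : Extensional Ψ → IsWNU Ψ → IsWNU (project Ψ)
    project-WNU ext (2≤k , idem , wnu) = 2≤k , project-idempotent idem , λ a b j j′ →
      trans (project-oneAt ext j a b)
            (trans (cong proj₁ (wnu _ _ j j′)) (sym (project-oneAt ext j′ a b)))

    project-satisfies : ∀ {S} → (2 ≤ k → Extensional Ψ) → SatisfiesAll S Ψ →
                        SatisfiesAll S (project Ψ)
    project-satisfies ext sat idempotence    t = project-idempotent (sat idempotence t)
    project-satisfies ext sat conservativity t = project-conservative (sat conservativity t)
    project-satisfies ext sat 3-NU           t with sat 3-NU t
    ... | refl , nu = project-3NU (ext (s≤s (s≤s z≤n))) (refl , nu)
    project-satisfies ext sat WNU            t = project-WNU (ext (proj₁ (sat WNU t))) (sat WNU t)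

module Backward {V : Set} {ℓ} {_<_ : Rel (V × Bool) ℓ} (compare : Trichotomous _≡_ _<_)
                {H : BrGraph V} {S : Property → Bool} where

  open Canonical compare using (extensionalise)
  open Projection

  backward : HasParitySymPolymorphism H S → HasPolymorphism H S
  -- A nullary Φ has no canonical version, but neither is it 3-NU or WNU.
  backward (zero , Φ , pol , symmetric , sat) =
    zero , project Φ , project-polymorphism {H = H} (reads-refl Φ) symmetric pol ,
    project-satisfies (λ ()) sat
  backward (suc k , Φ , pol , symmetric , sat) with extensionalise S Φ sat
  ... | Ψ , ext , reads , satΨ =
    suc k , project Ψ , project-polymorphism {H = H} reads symmetric pol ,
    project-satisfies (λ _ → ext) satΨ

×-compare≡ : ∀ {A B : Set} {ℓ₁ ℓ₂} {_<₁_ : Rel A ℓ₁} {_<₂_ : Rel B ℓ₂} →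
  Trichotomous _≡_ _<₁_ → Trichotomous _≡_ _<₂_ → Trichotomous _≡_ (×-Lex _≡_ _<₁_ _<₂_)
×-compare≡ compare₁ compare₂ p q with ×-compare sym compare₁ compare₂ p q
... | tri< p<q p≢q p≯q = tri< p<q (p≢q ∘ ≡⇒≡×≡) p≯q
... | tri≈ p≮q p≡q p≯q = tri≈ p≮q (≡×≡⇒≡ p≡q) p≯q
... | tri> p≮q p≢q p>q = tri> p≮q (p≢q ∘ ≡⇒≡×≡) p>q

proposition5p1 : (n : ℕ) (H : BrGraph (Fin n)) (S : Property → Bool) →
    HasPolymorphism H S ⇔ HasParitySymPolymorphism H S
proposition5p1 n H S = mk⇔ forward backward
  where
  open Forward Fin.<-cmp {H} {S} using (forward)
  open Backward (×-compare≡ Fin.<-cmp Bool.<-cmp) {H} {S} using (backward)
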